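{- Let $\Phi,\Psi$ be $\mathcal L_\Diamond$-types with $(\Phi,\Psi)$ sensible. (1) If ${\circ}\varphi$ is maximal in $\Phi^+$, then $(\Phi,\Psi\setminus{\circ}\varphi)$ is sensible. (2) If $\Diamond\varphi$ is maximal in $\Phi^+$ and $\varphi\in\Phi^+$, then $(\Phi,\Psi\setminus\Diamond\varphi)$ is sensible.
   Context: $\mathcal L_\Diamond$: formulas built from $\bot$, propositional variables, $\wedge,\vee,\to$, ${\circ},\Diamond$. An $\mathcal L_\Diamond$-type is a pair $\Phi=(\Phi^+;\Phi^-)$ of finite sets of $\mathcal L_\Diamond$-formulas with: $\Phi^+\cap\Phi^-=\varnothing$; $\bot\notin\Phi^+$; $\varphi\wedge\psi\in\Phi^+\Rightarrow\varphi,\psi\in\Phi^+$; $\varphi\wedge\psi\in\Phi^-\Rightarrow\varphi\in\Phi^-$ or $\psi\in\Phi^-$; $\varphi\vee\psi\in\Phi^+\Rightarrow\varphi\in\Phi^+$ or $\psi\in\Phi^+$; $\varphi\vee\psi\in\Phi^-\Rightarrow\varphi,\psi\in\Phi^-$; $\varphi\to\psi\in\Phi^+\Rightarrow\varphi\in\Phi^-$ or $\psi\in\Phi^+$; $\varphi\to\psi\in\Phi^-\Rightarrow\psi\in\Phi^-$; $\Diamond\varphi\in\Phi^-\Rightarrow\varphi\in\Phi^-$. A pair $(\Phi,\Psi)$ of pairs of sets of formulas is sensible if: ${\circ}\varphi\in\Phi^+\Rightarrow\varphi\in\Psi^+$; ${\circ}\varphi\in\Phi^-\Rightarrow\varphi\in\Psi^-$;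 $\Diamond\varphi\in\Phi^+\Rightarrow\varphi\in\Phi^+$ or $\Diamond\varphi\in\Psi^+$; $\Diamond\varphi\in\Phi^-\Rightarrow\Diamond\varphi\in\Psi^-$. A temporal formula is one of the form ${\circ}\psi$ or $\Diamond\psi$. For a set $\Gamma$ of formulas, $\theta\in\Gamma$ is maximal in $\Gamma$ if no temporal formula in $\Gamma$ other than $\theta$ has $\theta$ as a subformula. ${\rm sup}(\theta)$ is the set of all formulas having $\theta$ as a subformula, and $\Psi\setminus\theta:=(\Psi^+\setminus{\rm sup}(\theta),\Psi^-)$. -}

module Defs where

open import Data.Nat using (ℕ)
import Data.Nat.Properties as ℕP
open import Data.List using (List; filter)
open import Data.List.Membership.Propositional using (_∈_; _∉_)
open import Data.Product using (_×_; _,_)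
open import Data.Sum using (_⊎_; inj₁; inj₂)
open import Data.Empty using (⊥)
open import Relation.Nullary using (¬_; Dec; yes; no)
open import Relation.Nullary.Decidable using (¬?; _⊎-dec_)
open import Relation.Binary.PropositionalEquality using (_≡_; refl; cong; cong₂)

infixr 6 _∧_
infixr 5 _∨_
infixr 4 _⇒_
data Formula : Set where
  ⊥f  : Formula
  var : ℕ → Formula
  _∧_ : Formula → Formula → Formula
  _∨_ : Formula → Formula → Formula
  _⇒_ : Formula → Formula → Formula
  ○   : Formula → Formula
  ◇   : Formula → Formula

_≟_ : (φ ψ : Formula) → Dec (φ ≡ ψ)
⊥f ≟ ⊥f = yes refl
var m ≟ var n with m ℕP.≟ n
... | yes refl = yes refl
... | no ne = no λ { refl → ne refl }
(a ∧ b) ≟ (c ∧ d) with a ≟ c | b ≟ d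
... | yes refl | yes refl = yes refl
... | no ne | _ = no λ { refl → ne refl }
... | _ | no ne = no λ { refl → ne refl }
(a ∨ b) ≟ (c ∨ d) with a ≟ c | b ≟ d
... | yes refl | yes refl = yes refl
... | no ne | _ = no λ { refl → ne refl }
... | _ | no ne = no λ { refl → ne refl }
(a ⇒ b) ≟ (c ⇒ d) with a ≟ c | b ≟ d
... | yes refl | yes refl = yes refl
... | no ne | _ = no λ { refl → ne refl }
... | _ | no ne = no λ { refl → ne refl }
○ a ≟ ○ b with a ≟ b
... | yes refl = yes refl
... | no ne = no λ { refl → ne refl }
◇ a ≟ ◇ b with a ≟ b
... | yes refl = yes refl
... | no ne = no λ { refl → ne refl }
⊥f ≟ var _ = no λ ()
⊥f ≟ (_ ∧ _) = no λ ()
⊥f ≟ (_ ∨ _) = no λ ()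
⊥f ≟ (_ ⇒ _) = no λ ()
⊥f ≟ ○ _ = no λ ()
⊥f ≟ ◇ _ = no λ ()
var _ ≟ ⊥f = no λ ()
var _ ≟ (_ ∧ _) = no λ ()
var _ ≟ (_ ∨ _) = no λ ()
var _ ≟ (_ ⇒ _) = no λ ()
var _ ≟ ○ _ = no λ ()
var _ ≟ ◇ _ = no λ ()
(_ ∧ _) ≟ ⊥f = no λ ()
(_ ∧ _) ≟ var _ = no λ ()
(_ ∧ _) ≟ (_ ∨ _) = no λ ()
(_ ∧ _) ≟ (_ ⇒ _) = no λ ()
(_ ∧ _) ≟ ○ _ = no λ ()
(_ ∧ _) ≟ ◇ _ = no λ ()
(_ ∨ _) ≟ ⊥f = no λ ()
(_ ∨ _) ≟ var _ = no λ ()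
(_ ∨ _) ≟ (_ ∧ _) = no λ ()
(_ ∨ _) ≟ (_ ⇒ _) = no λ ()
(_ ∨ _) ≟ ○ _ = no λ ()
(_ ∨ _) ≟ ◇ _ = no λ ()
(_ ⇒ _) ≟ ⊥f = no λ ()
(_ ⇒ _) ≟ var _ = no λ ()
(_ ⇒ _) ≟ (_ ∧ _) = no λ ()
(_ ⇒ _) ≟ (_ ∨ _) = no λ ()
(_ ⇒ _) ≟ ○ _ = no λ ()
(_ ⇒ _) ≟ ◇ _ = no λ ()
○ _ ≟ ⊥f = no λ ()
○ _ ≟ var _ = no λ ()
○ _ ≟ (_ ∧ _) = no λ ()
○ _ ≟ (_ ∨ _) = no λ ()
○ _ ≟ (_ ⇒ _) = no λ ()
○ _ ≟ ◇ _ = no λ ()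
◇ _ ≟ ⊥f = no λ ()
◇ _ ≟ var _ = no λ ()
◇ _ ≟ (_ ∧ _) = no λ ()
◇ _ ≟ (_ ∨ _) = no λ ()
◇ _ ≟ (_ ⇒ _) = no λ ()
◇ _ ≟ ○ _ = no λ ()

_≼_ : Formula → Formula → Set
θ ≼ ⊥f      = θ ≡ ⊥f
θ ≼ var n   = θ ≡ var n
θ ≼ (a ∧ b) = θ ≡ (a ∧ b) ⊎ (θ ≼ a ⊎ θ ≼ b)
θ ≼ (a ∨ b) = θ ≡ (a ∨ b) ⊎ (θ ≼ a ⊎ θ ≼ b)
θ ≼ (a ⇒ b) = θ ≡ (a ⇒ b) ⊎ (θ ≼ a ⊎ θ ≼ b)
θ ≼ ○ a     = θ ≡ ○ a ⊎ θ ≼ a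
θ ≼ ◇ a     = θ ≡ ◇ a ⊎ θ ≼ a

_≼?_ : (θ χ : Formula) → Dec (θ ≼ χ)
θ ≼? ⊥f      = θ ≟ ⊥f
θ ≼? var n   = θ ≟ var n
θ ≼? (a ∧ b) = (θ ≟ (a ∧ b)) ⊎-dec ((θ ≼? a) ⊎-dec (θ ≼? b))
θ ≼? (a ∨ b) = (θ ≟ (a ∨ b)) ⊎-dec ((θ ≼? a) ⊎-dec (θ ≼? b))
θ ≼? (a ⇒ b) = (θ ≟ (a ⇒ b)) ⊎-dec ((θ ≼? a) ⊎-dec (θ ≼? b))
θ ≼? ○ a     = (θ ≟ ○ a) ⊎-dec (θ ≼? a)
θ ≼? ◇ a     = (θ ≟ ◇ a) ⊎-dec (θ ≼? a)

-- a pair of finite sets of formulas (Φ⁺ ; Φ⁻), finite sets as lists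
record Pair : Set where
  constructor ⟨_∣_⟩
  field
    pos : List Formula
    neg : List Formula
open Pair public

record IsType (Φ : Pair) : Set where
  field
    disjoint : ∀ {φ} → φ ∈ pos Φ → φ ∉ neg Φ
    ⊥∉       : ⊥f ∉ pos Φ
    ∧⁺ : ∀ {φ ψ} → (φ ∧ ψ) ∈ pos Φ → φ ∈ pos Φ × ψ ∈ pos Φ
    ∧⁻ : ∀ {φ ψ} → (φ ∧ ψ) ∈ neg Φ → φ ∈ neg Φ ⊎ ψ ∈ neg Φ
    ∨⁺ : ∀ {φ ψ} → (φ ∨ ψ) ∈ pos Φ → φ ∈ pos Φ ⊎ ψ ∈ pos Φ
    ∨⁻ : ∀ {φ ψ} → (φ ∨ ψ) ∈ neg Φ → φ ∈ neg Φ × ψ ∈ neg Φ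
    ⇒⁺ : ∀ {φ ψ} → (φ ⇒ ψ) ∈ pos Φ → φ ∈ neg Φ ⊎ ψ ∈ pos Φ
    ⇒⁻ : ∀ {φ ψ} → (φ ⇒ ψ) ∈ neg Φ → ψ ∈ neg Φ
    ◇⁻ : ∀ {φ} → ◇ φ ∈ neg Φ → φ ∈ neg Φ

record Sensible (Φ Ψ : Pair) : Set where
  field
    ○⁺ : ∀ {φ} → ○ φ ∈ pos Φ → φ ∈ pos Ψ
    ○⁻ : ∀ {φ} → ○ φ ∈ neg Φ → φ ∈ neg Ψ
    ◇⁺ : ∀ {φ} → ◇ φ ∈ pos Φ → φ ∈ pos Φ ⊎ ◇ φ ∈ pos Ψ
    ◇⁻ : ∀ {φ} → ◇ φ ∈ neg Φ → ◇ φ ∈ neg Ψ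

data Temporal : Formula → Set where
  temp○ : ∀ φ → Temporal (○ φ)
  temp◇ : ∀ φ → Temporal (◇ φ)

Maximal : Formula → List Formula → Set
Maximal θ Γ = θ ∈ Γ × (∀ χ → χ ∈ Γ → Temporal χ → θ ≼ χ → χ ≡ θ)

_∖_ : Pair → Formula → Pair
Ψ ∖ θ = ⟨ filter (λ χ → ¬? (θ ≼? χ)) (pos Ψ) ∣ neg Ψ ⟩

-- Removing sup(θ) from Ψ⁺ only endangers the clauses ○ψ ∈ Φ⁺ ⇒ ψ ∈ Ψ⁺ and
-- ◇ψ ∈ Φ⁺ ⇒ ψ ∈ Φ⁺ ∨ ◇ψ ∈ Ψ⁺ when θ lies inside ψ, resp. ◇ψ.  If θ is maximal
-- in Φ⁺, then θ inside ψ would force ○ψ = θ, a formula containing itself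
-- properly; and θ inside ◇ψ forces ◇ψ = θ, which is impossible for θ = ○φ and,
-- for θ = ◇φ, is settled by the hypothesis φ ∈ Φ⁺.
module Submission where

open import Defs
open import Data.List.Membership.Propositional using (_∈_)
open import Data.List.Membership.Propositional.Properties using (∈-filter⁺)
open import Data.Product using (_×_; _,_)
open import Data.Sum using (_⊎_; inj₁; inj₂)
open import Data.Nat using (ℕ; suc; _+_; _≤_)
open import Data.Nat.Properties using (≤-refl; ≤-trans; m≤m+n; m≤n+m; m≤n⇒m≤1+n; 1+n≰n)
open import Relation.Nullary using (¬_; yes; no)
open import Relation.Nullary.Decidable using (¬?)
open import Relation.Binary.PropositionalEquality using (_≡_; refl)

size : Formula → ℕ
size ⊥f      = 1
size (var _) = 1
size (a ∧ b) = suc (size a + size b)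
size (a ∨ b) = suc (size a + size b)
size (a ⇒ b) = suc (size a + size b)
size (○ a)   = suc (size a)
size (◇ a)   = suc (size a)

≤-left-operand : ∀ {k m} n → k ≤ m → k ≤ suc (m + n)
≤-left-operand {m = m} n k≤m = m≤n⇒m≤1+n (≤-trans k≤m (m≤m+n m n))

≤-right-operand : ∀ {k n} m → k ≤ n → k ≤ suc (m + n)
≤-right-operand {n = n} m k≤n = m≤n⇒m≤1+n (≤-trans k≤n (m≤n+m n m))

≼⇒size≤ : ∀ {θ} χ → θ ≼ χ → size θ ≤ size χ
≼⇒size≤ ⊥f      refl            = ≤-refl
≼⇒size≤ (var n) refl            = ≤-refl
≼⇒size≤ (a ∧ b) (inj₁ refl)     = ≤-refl
≼⇒size≤ (a ∧ b) (inj₂ (inj₁ p)) = ≤-left-operand (size b) (≼⇒size≤ a p)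
≼⇒size≤ (a ∧ b) (inj₂ (inj₂ p)) = ≤-right-operand (size a) (≼⇒size≤ b p)
≼⇒size≤ (a ∨ b) (inj₁ refl)     = ≤-refl
≼⇒size≤ (a ∨ b) (inj₂ (inj₁ p)) = ≤-left-operand (size b) (≼⇒size≤ a p)
≼⇒size≤ (a ∨ b) (inj₂ (inj₂ p)) = ≤-right-operand (size a) (≼⇒size≤ b p)
≼⇒size≤ (a ⇒ b) (inj₁ refl)     = ≤-refl
≼⇒size≤ (a ⇒ b) (inj₂ (inj₁ p)) = ≤-left-operand (size b) (≼⇒size≤ a p)
≼⇒size≤ (a ⇒ b) (inj₂ (inj₂ p)) = ≤-right-operand (size a) (≼⇒size≤ b p)
≼⇒size≤ (○ a)   (inj₁ refl)     = ≤-refl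
≼⇒size≤ (○ a)   (inj₂ p)        = m≤n⇒m≤1+n (≼⇒size≤ a p)
≼⇒size≤ (◇ a)   (inj₁ refl)     = ≤-refl
≼⇒size≤ (◇ a)   (inj₂ p)        = m≤n⇒m≤1+n (≼⇒size≤ a p)

○-⋠-body : ∀ φ → ¬ (○ φ ≼ φ)
○-⋠-body φ p = 1+n≰n (≼⇒size≤ φ p)

∈-∖⁺ : ∀ {θ χ} Ψ → χ ∈ pos Ψ → ¬ (θ ≼ χ) → χ ∈ pos (Ψ ∖ θ)
∈-∖⁺ {θ} Ψ χ∈ θ⋠χ = ∈-filter⁺ (λ χ → ¬? (θ ≼? χ)) χ∈ θ⋠χ

sensible-∖ : ∀ {Φ Ψ} θ → Sensible Φ Ψ →
  (∀ {ψ} → ○ ψ ∈ pos Φ → ¬ (θ ≼ ψ)) →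
  (∀ {ψ} → ◇ ψ ∈ pos Φ → θ ≼ ◇ ψ → ψ ∈ pos Φ) →
  Sensible Φ (Ψ ∖ θ)
sensible-∖ {Φ} {Ψ} θ S ○-safe ◇-safe = record
  { ○⁺ = λ ○ψ∈ → ∈-∖⁺ Ψ (S.○⁺ ○ψ∈) (○-safe ○ψ∈)
  ; ○⁻ = S.○⁻
  ; ◇⁺ = ◇⁺
  ; ◇⁻ = S.◇⁻
  }
  where
  module S = Sensible S
  ◇⁺ : ∀ {ψ} → ◇ ψ ∈ pos Φ → ψ ∈ pos Φ ⊎ ◇ ψ ∈ pos (Ψ ∖ θ)
  ◇⁺ {ψ} ◇ψ∈ with S.◇⁺ ◇ψ∈ | θ ≼? ◇ ψ
  ... | inj₁ ψ∈  | _        = inj₁ ψ∈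
  ... | inj₂ ◇ψ∈Ψ | yes θ≼◇ψ = inj₁ (◇-safe ◇ψ∈ θ≼◇ψ)
  ... | inj₂ ◇ψ∈Ψ | no θ⋠◇ψ  = inj₂ (∈-∖⁺ Ψ ◇ψ∈Ψ θ⋠◇ψ)

maximal⇒⋠-○-body : ∀ {θ Γ ψ} → Maximal θ Γ → ○ ψ ∈ Γ → ¬ (θ ≼ ψ)
maximal⇒⋠-○-body {ψ = ψ} (_ , max) ○ψ∈ θ≼ψ with max (○ ψ) ○ψ∈ (temp○ ψ) (inj₂ θ≼ψ)
... | refl = ○-⋠-body ψ θ≼ψ

maximal⇒≼-◇ : ∀ {θ Γ ψ} → Maximal θ Γ → ◇ ψ ∈ Γ → θ ≼ ◇ ψ → ◇ ψ ≡ θ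
maximal⇒≼-◇ {ψ = ψ} (_ , max) ◇ψ∈ = max (◇ ψ) ◇ψ∈ (temp◇ ψ)

lemma10p2 : (Φ Ψ : Pair) → IsType Φ → IsType Ψ → Sensible Φ Ψ →
    ((∀ φ → Maximal (○ φ) (pos Φ) → Sensible Φ (Ψ ∖ ○ φ))
    × (∀ φ → Maximal (◇ φ) (pos Φ) → φ ∈ pos Φ → Sensible Φ (Ψ ∖ ◇ φ)))
lemma10p2 Φ Ψ _ _ S = next-case , eventually-case
  where
  next-case : ∀ φ → Maximal (○ φ) (pos Φ) → Sensible Φ (Ψ ∖ ○ φ)
  next-case φ max = sensible-∖ (○ φ) S (maximal⇒⋠-○-body max) ◇-safe
    where
    ◇-safe : ∀ {ψ} → ◇ ψ ∈ pos Φ → ○ φ ≼ ◇ ψ → ψ ∈ pos Φ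
    ◇-safe ◇ψ∈ ○φ≼◇ψ with maximal⇒≼-◇ max ◇ψ∈ ○φ≼◇ψ
    ... | ()

  eventually-case : ∀ φ → Maximal (◇ φ) (pos Φ) → φ ∈ pos Φ → Sensible Φ (Ψ ∖ ◇ φ)
  eventually-case φ max φ∈ = sensible-∖ (◇ φ) S (maximal⇒⋠-○-body max) ◇-safe
    where
    ◇-safe : ∀ {ψ} → ◇ ψ ∈ pos Φ → ◇ φ ≼ ◇ ψ → ψ ∈ pos Φ
    ◇-safe ◇ψ∈ ◇φ≼◇ψ with maximal⇒≼-◇ max ◇ψ∈ ◇φ≼◇ψ
    ... | refl = φ∈
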